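{- Let $k\ge 1$ and let $G$ be a graph such that the near-$k$-twin relation $\rho_k$ of $G$ is an equivalence relation on $V(G)$. Let $U$ and $V$ be two equivalence classes of $\rho_k$ (possibly $U=V$), each with at least $4k+2$ vertices. Then for every $v\in V$ we have $\min\{|U\cap N(v)|,\ |U\setminus N(v)|\}\le 2k$.
   Context: Graphs are finite, simple and undirected. $N(v)=\{w\mid\{v,w\}\in E(G)\}$ (so $v\notin N(v)$), and $\mathop{\bigtriangleup}$ is symmetric difference. The near-$k$-twin relation $\rho_k$ of $G$ is the relation on $V(G)$ with $(u,v)\in\rho_k$ iff $|N(u)\mathop{\bigtriangleup} N(v)|\le k$. -}

module Defs where

open import Data.Nat using (ℕ; _≤_; _≤ᵇ_)
open import Data.Bool using (Bool; true; false; _xor_)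
open import Data.Fin using (Fin)
open import Data.Fin.Subset using (Subset; ∣_∣)
open import Data.Vec using (tabulate; zipWith)
open import Relation.Binary.PropositionalEquality using (_≡_)

record Graph (n : ℕ) : Set where
  field
    adj       : Fin n → Fin n → Bool
    symmetric : ∀ u v → adj u v ≡ adj v u
    irreflexive : ∀ v → adj v v ≡ false
open Graph public

N : ∀ {n} → Graph n → Fin n → Subset n
N G v = tabulate (adj G v)

_△_ : ∀ {n} → Subset n → Subset n → Subset n
A △ B = zipWith _xor_ A B

ρ : ∀ {n} → Graph n → ℕ → Fin n → Fin n → Set
ρ G k u v = ∣ N G u △ N G v ∣ ≤ k

class : ∀ {n} → Graph n → ℕ → Fin n → Subset n
class G k x = tabulate (λ w → ∣ N G x △ N G w ∣ ≤ᵇ k)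

-- Let V be the class of v and U that of a, and suppose both A = U ∩ N(v) and B = U ∖ N(v)
-- have more than 2k vertices.  For a vertex x let c(x) be the number of w ∈ V whose adjacency
-- to x differs from that of v.  Every w ∈ V is a near-k-twin of v, so double counting gives
-- Σ_x c(x) ≤ |V| k.  If x ∈ A and y ∈ B minimise c, then each w ∈ V either disagrees
-- with v at x or at y, or lies in N(x) △ N(y); as x, y are near-k-twins,
-- |V| ≤ c(x) + c(y) + k.  Together with (2k+1)(c(x) + c(y)) ≤ |A| c(x) + |B| c(y) ≤ |V| k
-- this forces |V| ≤ 2k.

module Submission where

open import Defs
open import Data.Bool using (Bool; true; false; not; _∧_; _xor_; T)
open import Data.Bool.Properties using (T-≡; T-not-≡; T-∧)
open import Data.Fin using (Fin; zero; suc)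
open import Data.Fin.Subset using (∣_∣; _∩_; _─_; _∈_)
open import Data.List using (List; filter; allFin)
open import Data.List.Extrema.Nat using (argmin; f[argmin]≤f[xs]; argmin-all)
import Data.List.Relation.Unary.All as All
open import Data.List.Relation.Unary.All.Properties using (all-filter)
open import Data.List.Membership.Propositional.Properties using (∈-filter⁺; ∈-allFin)
open import Data.Nat using (ℕ; zero; suc; z≤n; s≤s; _≤_; _<_; _+_; _*_; _⊓_; _≤ᵇ_; _≤?_)
open import Data.Nat.Properties
open import Algebra.Properties.Semiring.Sum +-*-semiring
  using (sum; sum-syntax; ∑-comm; ∑-distrib-+; *-distribʳ-sum; sum-replicate-zero)
open import Data.Nat.Tactic.RingSolver using (solve-∀)
open import Data.Product using (_×_; _,_; proj₁; proj₂; ∃-syntax)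
open import Data.Vec using (tabulate; zipWith; _∷_)
open import Data.Vec.Properties using ([]=⇒lookup; lookup∘tabulate)
open import Function using (_∘_; Equivalence)
open import Relation.Binary.PropositionalEquality using (_≡_; refl; sym; trans; cong; cong₂; subst)
open import Relation.Binary.Structures using (IsEquivalence)
open import Relation.Nullary using (yes; no; contradiction)
open import Relation.Nullary.Decidable using (T?)

⟦_⟧ : Bool → ℕ
⟦ true ⟧ = 1
⟦ false ⟧ = 0

sum-mono-≤ : ∀ {n} {f g : Fin n → ℕ} → (∀ i → f i ≤ g i) → sum f ≤ sum g
sum-mono-≤ {zero} _ = z≤n
sum-mono-≤ {suc n} f≤g = +-mono-≤ (f≤g zero) (sum-mono-≤ (f≤g ∘ suc))

sum-pos⇒∃ : ∀ {n} (p : Fin n → Bool) → 0 < ∑[ i < n ] ⟦ p i ⟧ → ∃[ i ] T (p i)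
sum-pos⇒∃ {suc n} p pos with p zero in p₀
... | true = zero , Equivalence.from T-≡ p₀
... | false with sum-pos⇒∃ (p ∘ suc) pos
...   | i , pᵢ = suc i , pᵢ

∃-minimiser : ∀ {n} (p : Fin n → Bool) (c : Fin n → ℕ) → 0 < ∑[ i < n ] ⟦ p i ⟧ →
  ∃[ x ] T (p x) × (∀ y → T (p y) → c x ≤ c y)
∃-minimiser {n} p c pos with sum-pos⇒∃ p pos
... | x₀ , px₀ = argmin c x₀ candidates , argmin-all c px₀ (all-filter (T? ∘ p) (allFin n)) , minimal
  where
  candidates : List (Fin _)
  candidates = filter (T? ∘ p) (allFin n)
  minimal : ∀ y → T (p y) → c (argmin c x₀ candidates) ≤ c y
  minimal y py = All.lookup (f[argmin]≤f[xs] x₀ candidates) (∈-filter⁺ (T? ∘ p) (∈-allFin y) py)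

∑-split-≥ : ∀ {n} (p q : Fin n → Bool) (c : Fin n → ℕ) {m₁ m₂ : ℕ} →
  (∀ i → T (p i ∧ q i) → m₁ ≤ c i) → (∀ i → T (p i ∧ not (q i)) → m₂ ≤ c i) →
  (∑[ i < n ] ⟦ p i ∧ q i ⟧) * m₁ + (∑[ i < n ] ⟦ p i ∧ not (q i) ⟧) * m₂ ≤ ∑[ i < n ] c i
∑-split-≥ {n} p q c {m₁} {m₂} h₁ h₂ = begin
  (∑[ i < n ] ⟦ p i ∧ q i ⟧) * m₁ + (∑[ i < n ] ⟦ p i ∧ not (q i) ⟧) * m₂
    ≡⟨ cong₂ _+_ (*-distribʳ-sum {n} m₁ _) (*-distribʳ-sum {n} m₂ _) ⟩
  ∑[ i < n ] (⟦ p i ∧ q i ⟧ * m₁) + ∑[ i < n ] (⟦ p i ∧ not (q i) ⟧ * m₂)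
    ≡⟨ ∑-distrib-+ {n} _ _ ⟨
  ∑[ i < n ] (⟦ p i ∧ q i ⟧ * m₁ + ⟦ p i ∧ not (q i) ⟧ * m₂)
    ≤⟨ sum-mono-≤ pointwise ⟩
  ∑[ i < n ] c i ∎
  where
  open ≤-Reasoning
  pointwise : ∀ i → ⟦ p i ∧ q i ⟧ * m₁ + ⟦ p i ∧ not (q i) ⟧ * m₂ ≤ c i
  pointwise i with p i | q i | h₁ i | h₂ i
  ... | false | _     | _  | _  = z≤n
  ... | true  | true  | h  | _  = ≤-trans (≤-reflexive (trans (+-identityʳ _) (*-identityˡ _))) (h _)
  ... | true  | false | _  | h  = ≤-trans (≤-reflexive (*-identityˡ _)) (h _)

∣tabulate∣ : ∀ {n} (p : Fin n → Bool) → ∣ tabulate p ∣ ≡ ∑[ i < n ] ⟦ p i ⟧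
∣tabulate∣ {zero} p = refl
∣tabulate∣ {suc n} p with p zero
... | true  = cong suc (∣tabulate∣ (p ∘ suc))
... | false = ∣tabulate∣ (p ∘ suc)

∈-tabulate⁻ : ∀ {n} {p : Fin n → Bool} {i} → i ∈ tabulate p → T (p i)
∈-tabulate⁻ {p = p} {i} i∈p =
  Equivalence.from T-≡ (trans (sym (lookup∘tabulate p i)) ([]=⇒lookup i∈p))

zipWith-tabulate : ∀ {n} {A B C : Set} (_⊕_ : A → B → C) (f : Fin n → A) (g : Fin n → B) →
  zipWith _⊕_ (tabulate f) (tabulate g) ≡ tabulate (λ i → f i ⊕ g i)
zipWith-tabulate {zero} _⊕_ f g = refl
zipWith-tabulate {suc n} _⊕_ f g = cong (_ ∷_) (zipWith-tabulate _⊕_ (f ∘ suc) (g ∘ suc))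

─-tabulate : ∀ {n} (p q : Fin n → Bool) → tabulate p ─ tabulate q ≡ tabulate (λ i → p i ∧ not (q i))
─-tabulate {zero} p q = refl
─-tabulate {suc n} p q with p zero | q zero
... | true  | true  = cong (_ ∷_) (─-tabulate (p ∘ suc) (q ∘ suc))
... | true  | false = cong (_ ∷_) (─-tabulate (p ∘ suc) (q ∘ suc))
... | false | true  = cong (_ ∷_) (─-tabulate (p ∘ suc) (q ∘ suc))
... | false | false = cong (_ ∷_) (─-tabulate (p ∘ suc) (q ∘ suc))

∣tabulate∩tabulate∣ : ∀ {n} (p q : Fin n → Bool) → ∣ tabulate p ∩ tabulate q ∣ ≡ ∑[ i < n ] ⟦ p i ∧ q i ⟧
∣tabulate∩tabulate∣ p q = trans (cong ∣_∣ (zipWith-tabulate _∧_ p q)) (∣tabulate∣ (λ i → p i ∧ q i))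

∣tabulate─tabulate∣ : ∀ {n} (p q : Fin n → Bool) → ∣ tabulate p ─ tabulate q ∣ ≡ ∑[ i < n ] ⟦ p i ∧ not (q i) ⟧
∣tabulate─tabulate∣ p q = trans (cong ∣_∣ (─-tabulate p q)) (∣tabulate∣ (λ i → p i ∧ not (q i)))

⟦⟧-cover : ∀ s p q → ⟦ s ⟧ ≤ ⟦ s ∧ not p ⟧ + ⟦ s ∧ q ⟧ + ⟦ p xor q ⟧
⟦⟧-cover false _     _     = z≤n
⟦⟧-cover true  false _     = s≤s z≤n
⟦⟧-cover true  true  true  = s≤s z≤n
⟦⟧-cover true  true  false = s≤s z≤n

[1+2k]s≤Vk⇒V≤s+k⇒V≤2k : ∀ k s V → suc (2 * k) * s ≤ V * k → V ≤ s + k → V ≤ 2 * k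
[1+2k]s≤Vk⇒V≤s+k⇒V≤2k k s V lower upper = *-cancelˡ-≤ (suc k) (+-cancelʳ-≤ (V * k) _ _ (begin
  suc k * V + V * k                    ≡⟨ split-V k V ⟩
  suc (2 * k) * V                      ≤⟨ *-monoʳ-≤ (suc (2 * k)) upper ⟩
  suc (2 * k) * (s + k)                ≡⟨ *-distribˡ-+ (suc (2 * k)) s k ⟩
  suc (2 * k) * s + suc (2 * k) * k    ≤⟨ +-monoˡ-≤ _ lower ⟩
  V * k + suc (2 * k) * k              ≤⟨ +-monoʳ-≤ (V * k) (m≤m+n _ k) ⟩
  V * k + (suc (2 * k) * k + k)        ≡⟨ cong (V * k +_) (split-2k k) ⟩
  V * k + suc k * (2 * k)              ≡⟨ +-comm (V * k) _ ⟩
  suc k * (2 * k) + V * k              ∎))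
  where
  open ≤-Reasoning
  split-V : ∀ k V → suc k * V + V * k ≡ suc (2 * k) * V
  split-V = solve-∀
  split-2k : ∀ k → suc (2 * k) * k + k ≡ suc k * (2 * k)
  split-2k = solve-∀

module _ {n} (G : Graph n) (k : ℕ) where

  inClass : Fin n → Fin n → Bool
  inClass x w = ∣ N G x △ N G w ∣ ≤ᵇ k

  disagree : Fin n → Fin n → Fin n → Bool
  disagree u w x = adj G u x xor adj G w x

  disagreements : (Fin n → Bool) → Fin n → Fin n → ℕ
  disagreements S v x = ∑[ w < n ] ⟦ S w ∧ disagree v w x ⟧

  ∣N△N∣ : ∀ u w → ∣ N G u △ N G w ∣ ≡ ∑[ x < n ] ⟦ disagree u w x ⟧
  ∣N△N∣ u w = trans (cong ∣_∣ (zipWith-tabulate _xor_ (adj G u) (adj G w))) (∣tabulate∣ (disagree u w))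

  ∑-disagreements≤ : ∀ S v → (∀ w → T (S w) → ρ G k v w) →
    ∑[ x < n ] disagreements S v x ≤ (∑[ w < n ] ⟦ S w ⟧) * k
  ∑-disagreements≤ S v S⊆ρᵥ = begin
    ∑[ x < n ] ∑[ w < n ] ⟦ S w ∧ disagree v w x ⟧  ≡⟨ ∑-comm (λ x w → ⟦ S w ∧ disagree v w x ⟧) ⟩
    ∑[ w < n ] ∑[ x < n ] ⟦ S w ∧ disagree v w x ⟧  ≤⟨ sum-mono-≤ column ⟩
    ∑[ w < n ] (⟦ S w ⟧ * k)                       ≡⟨ *-distribʳ-sum {n} k _ ⟨
    (∑[ w < n ] ⟦ S w ⟧) * k                       ∎
    where
    open ≤-Reasoning
    column : ∀ w → ∑[ x < n ] ⟦ S w ∧ disagree v w x ⟧ ≤ ⟦ S w ⟧ * k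
    column w with S w | S⊆ρᵥ w
    ... | false | _ = ≤-reflexive (sum-replicate-zero n)
    ... | true | v∼w = begin
      ∑[ x < n ] ⟦ disagree v w x ⟧  ≡⟨ ∣N△N∣ v w ⟨
      ∣ N G v △ N G w ∣              ≤⟨ v∼w _ ⟩
      k                              ≡⟨ *-identityˡ k ⟨
      1 * k                          ∎

  ∑S≤pair-disagreements : ∀ S v x y → T (adj G v x) → T (not (adj G v y)) → ρ G k x y →
    ∑[ w < n ] ⟦ S w ⟧ ≤ disagreements S v x + disagreements S v y + k
  ∑S≤pair-disagreements S v x y vx v≁y x∼y = begin
    ∑[ w < n ] ⟦ S w ⟧
      ≤⟨ sum-mono-≤ covered ⟩
    ∑[ w < n ] (⟦ S w ∧ disagree v w x ⟧ + ⟦ S w ∧ disagree v w y ⟧ + ⟦ disagree x y w ⟧)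
      ≡⟨ ∑-distrib-+ {n} _ _ ⟩
    ∑[ w < n ] (⟦ S w ∧ disagree v w x ⟧ + ⟦ S w ∧ disagree v w y ⟧) + ∑[ w < n ] ⟦ disagree x y w ⟧
      ≡⟨ cong (_+ _) (∑-distrib-+ {n} _ _) ⟩
    disagreements S v x + disagreements S v y + ∑[ w < n ] ⟦ disagree x y w ⟧
      ≤⟨ +-monoʳ-≤ _ (subst (_≤ k) (∣N△N∣ x y) x∼y) ⟩
    disagreements S v x + disagreements S v y + k ∎
    where
    open ≤-Reasoning
    covered : ∀ w → ⟦ S w ⟧ ≤ ⟦ S w ∧ disagree v w x ⟧ + ⟦ S w ∧ disagree v w y ⟧ + ⟦ disagree x y w ⟧
    -- a w ∈ S agreeing with v at x and at y is adjacent to x but not to y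
    covered w rewrite Equivalence.to T-≡ vx | Equivalence.to T-not-≡ v≁y
                    | symmetric G x w | symmetric G y w = ⟦⟧-cover (S w) (adj G w x) (adj G w y)

  ∑S≤2k : ∀ S p v → (∀ w → T (S w) → ρ G k v w) → (∀ x y → T (p x) → T (p y) → ρ G k x y) →
    2 * k < ∑[ i < n ] ⟦ p i ∧ adj G v i ⟧ → 2 * k < ∑[ i < n ] ⟦ p i ∧ not (adj G v i) ⟧ →
    ∑[ w < n ] ⟦ S w ⟧ ≤ 2 * k
  ∑S≤2k S p v S⊆ρᵥ p-clique 2k<∑A 2k<∑B
    with ∃-minimiser _ (disagreements S v) (≤-trans (s≤s z≤n) 2k<∑A)
       | ∃-minimiser _ (disagreements S v) (≤-trans (s≤s z≤n) 2k<∑B)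
  ... | x , Ax , x-min | y , By , y-min = [1+2k]s≤Vk⇒V≤s+k⇒V≤2k k (c x + c y) (∑[ w < n ] ⟦ S w ⟧) (begin
    suc (2 * k) * (c x + c y)                                ≡⟨ *-distribˡ-+ (suc (2 * k)) (c x) (c y) ⟩
    suc (2 * k) * c x + suc (2 * k) * c y                    ≤⟨ +-mono-≤ (*-monoˡ-≤ (c x) 2k<∑A) (*-monoˡ-≤ (c y) 2k<∑B) ⟩
    (∑[ i < n ] ⟦ p i ∧ adj G v i ⟧) * c x
      + (∑[ i < n ] ⟦ p i ∧ not (adj G v i) ⟧) * c y         ≤⟨ ∑-split-≥ p (adj G v) c x-min y-min ⟩
    ∑[ i < n ] c i                                           ≤⟨ ∑-disagreements≤ S v S⊆ρᵥ ⟩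
    (∑[ w < n ] ⟦ S w ⟧) * k                                 ∎)
    (∑S≤pair-disagreements S v x y (proj₂ (Equivalence.to T-∧ Ax)) (proj₂ (Equivalence.to T-∧ By))
      (p-clique x y (proj₁ (Equivalence.to T-∧ Ax)) (proj₁ (Equivalence.to T-∧ By))))
    where
    open ≤-Reasoning
    c : Fin n → ℕ
    c = disagreements S v

∣class∣≤2k : ∀ {n} (G : Graph n) k → IsEquivalence (ρ G k) → ∀ a b v → v ∈ class G k b →
  2 * k < ∣ class G k a ∩ N G v ∣ → 2 * k < ∣ class G k a ─ N G v ∣ → ∣ class G k b ∣ ≤ 2 * k
∣class∣≤2k G k ρ-equivalence a b v v∈V 2k<∣A∣ 2k<∣B∣ =
  subst (_≤ 2 * k) (sym (∣tabulate∣ (inClass G k b)))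
    (∑S≤2k G k (inClass G k b) (inClass G k a) v V⊆ρᵥ U-clique
      (subst (2 * k <_) (∣tabulate∩tabulate∣ (inClass G k a) (adj G v)) 2k<∣A∣)
      (subst (2 * k <_) (∣tabulate─tabulate∣ (inClass G k a) (adj G v)) 2k<∣B∣))
  where
  open IsEquivalence ρ-equivalence renaming (sym to ρ-sym; trans to ρ-trans)
  V⊆ρᵥ : ∀ w → T (inClass G k b w) → ρ G k v w
  V⊆ρᵥ w Vw = ρ-trans (ρ-sym (≤ᵇ⇒≤ _ _ (∈-tabulate⁻ v∈V))) (≤ᵇ⇒≤ _ _ Vw)
  U-clique : ∀ x y → T (inClass G k a x) → T (inClass G k a y) → ρ G k x y
  U-clique x y Ux Uy = ρ-trans (ρ-sym (≤ᵇ⇒≤ _ _ Ux)) (≤ᵇ⇒≤ _ _ Uy)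

2k<4k+2 : ∀ k → 2 * k < 4 * k + 2
2k<4k+2 k = subst (2 * k <_) (4k+2≡ k) (s≤s (m≤m+n (2 * k) (suc (2 * k))))
  where
  4k+2≡ : ∀ k → suc (2 * k + suc (2 * k)) ≡ 4 * k + 2
  4k+2≡ = solve-∀

lemma8 : ∀ {n} (G : Graph n) (k : ℕ) → 1 ≤ k →
    IsEquivalence (ρ G k) →
    (a b : Fin n) →
    4 * k + 2 ≤ ∣ class G k a ∣ →
    4 * k + 2 ≤ ∣ class G k b ∣ →
    (v : Fin n) → v ∈ class G k b →
    ∣ class G k a ∩ N G v ∣ ⊓ ∣ class G k a ─ N G v ∣ ≤ 2 * k
lemma8 G k _ ρ-equivalence a b _ 4k+2≤∣V∣ v v∈V
  with ∣ class G k a ∩ N G v ∣ ≤? 2 * k | ∣ class G k a ─ N G v ∣ ≤? 2 * k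
... | yes ∣A∣≤2k | _ = m≤n⇒m⊓o≤n _ ∣A∣≤2k
... | no _ | yes ∣B∣≤2k = m≤n⇒o⊓m≤n _ ∣B∣≤2k
... | no ∣A∣≰2k | no ∣B∣≰2k = contradiction
  (≤-trans 4k+2≤∣V∣ (∣class∣≤2k G k ρ-equivalence a b v v∈V (≰⇒> ∣A∣≰2k) (≰⇒> ∣B∣≰2k)))
  (<⇒≱ (2k<4k+2 k))
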